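{- For all $\lambda$-terms $M,N$ and variable $x$, $T_r(M[N/x])=\{a[\vec b/x]\mid a\in T_r(M),\ \vec b \text{ a finite list of elements of } T_r(N),\ a[\vec b/x]\neq0\}$.
   Context: Rigid resource terms: $a ::= x\mid \lambda x.a\mid \langle c\rangle\vec d\mid 0$, $\vec d=(d_1,\dots,d_n)$ a finite list of rigid terms; up to $\alpha$; $0$ absorbing. Rigid substitution $a[\vec b/x]$, $\vec b=(b_1,\dots,b_k)$: if $x$ has exactly $k$ free occurrences in $a$, the term obtained by replacing (capture-avoidingly) the $i$-th free occurrence in left-to-right order by $b_i$; otherwise $0$. Rigid expansion: $T_r(x)=\{x\}$, $T_r(\lambda x.M)=\{\lambda x.a\mid a\in T_r(M)\}$, $T_r(PQ)=\{\langle c\rangle(d_1,\dots,d_n)\mid c\in T_r(P), n\ge0, d_i\in T_r(Q)\}$. $M[N/x]$ is capture-avoiding substitution of $\lambda$-terms. -}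

module Defs where

open import Data.Nat using (ℕ; suc; _<_; _≟_)
open import Data.List using (List; []; _∷_)
open import Data.List.Relation.Unary.All using (All)
open import Data.Maybe using (Maybe; just; nothing)
open import Data.Product using (_×_; _,_)
open import Relation.Nullary using (yes; no)

-- Locally nameless representation (α-equivalence classes are represented
-- canonically): free variables are names (ℕ), bound variables are
-- de Bruijn indices (ℕ).

data Term : Set where
  fvar : ℕ → Term
  bvar : ℕ → Term
  lam  : Term → Term
  app  : Term → Term → Term

data LCat : ℕ → Term → Set where
  lc-fvar : ∀ {k x} → LCat k (fvar x)
  lc-bvar : ∀ {k i} → i < k → LCat k (bvar i)
  lc-lam  : ∀ {k M} → LCat (suc k) M → LCat k (lam M)
  lc-app  : ∀ {k P Q} → LCat k P → LCat k Q → LCat k (app P Q)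

-- λ-terms proper = locally closed pre-terms
LC : Term → Set
LC = LCat 0

-- M[N/x] : substitution of the free name x by N (capture-avoiding, since
-- in the locally nameless representation N's free variables are names)
subst : ℕ → Term → Term → Term
subst x N (fvar y) with x ≟ y
... | yes _ = N
... | no  _ = fvar y
subst x N (bvar i)  = bvar i
subst x N (lam M)   = lam (subst x N M)
subst x N (app P Q) = app (subst x N P) (subst x N Q)

-- Rigid resource terms different from 0 (0 is absorbing, so every term
-- containing 0 is 0; the term 0 is represented by 'nothing' in Maybe RTerm).
data RTerm : Set where
  rfvar : ℕ → RTerm
  rbvar : ℕ → RTerm
  rlam  : RTerm → RTerm
  rapp  : RTerm → List RTerm → RTerm

mutual
  fill : ℕ → RTerm → List RTerm → Maybe (RTerm × List RTerm)
  fill x (rfvar y) bs with x ≟ y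
  fill x (rfvar y) []       | yes _ = nothing
  fill x (rfvar y) (b ∷ bs) | yes _ = just (b , bs)
  fill x (rfvar y) bs       | no  _ = just (rfvar y , bs)
  fill x (rbvar i) bs = just (rbvar i , bs)
  fill x (rlam a) bs with fill x a bs
  ... | nothing        = nothing
  ... | just (a' , rs) = just (rlam a' , rs)
  fill x (rapp c ds) bs with fill x c bs
  ... | nothing        = nothing
  ... | just (c' , rs) with fillList x ds rs
  ...   | nothing         = nothing
  ...   | just (ds' , ts) = just (rapp c' ds' , ts)

  fillList : ℕ → List RTerm → List RTerm → Maybe (List RTerm × List RTerm)
  fillList x [] bs = just ([] , bs)
  fillList x (d ∷ ds) bs with fill x d bs
  ... | nothing        = nothing
  ... | just (d' , rs) with fillList x ds rs
  ...   | nothing         = nothing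
  ...   | just (ds' , ts) = just (d' ∷ ds' , ts)

-- Rigid substitution a[bs/x]: defined (just) iff x has exactly length bs
-- free occurrences in a; nothing represents the result 0.
rsubst : ℕ → RTerm → List RTerm → Maybe RTerm
rsubst x a bs with fill x a bs
... | just (a' , []) = just a'
... | just (_ , _ ∷ _) = nothing
... | nothing = nothing

-- Rigid expansion as a membership relation: a ∈Tr M  iff  a ∈ T_r(M)
data _∈Tr_ : RTerm → Term → Set where
  tr-fvar : ∀ {x} → rfvar x ∈Tr fvar x
  tr-bvar : ∀ {i} → rbvar i ∈Tr bvar i
  tr-lam  : ∀ {a M} → a ∈Tr M → rlam a ∈Tr lam M
  tr-app  : ∀ {c P ds Q} → c ∈Tr P → All (_∈Tr Q) ds → rapp c ds ∈Tr app P Q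

module Submission where

-- Rigid substitution a[bs/x] is computed by  fill x a bs, which walks a from
-- left to right, replaces each free occurrence of x by the next element of
-- bs and returns the unused suffix; a[bs/x] ≠ 0 exactly when fill succeeds
-- with empty suffix (rsubst-fill⁺ / rsubst-fill⁻).  The argument is then two
-- inductions, carried out for fill with an arbitrary suffix so that they
-- compose through applications, whose arguments consume consecutive segments
-- of bs:
--   * soundness (fill-sound): filling an expansion of M with expansions of N
--     yields an expansion of M[N/x];
--   * completeness (fill-complete): every expansion of M[N/x] arises this
--     way, with a list bs of expansions of N that fill consumes exactly.

open import Defs
open import Data.Nat using (ℕ; _≟_)
open import Data.List using (List; []; _∷_; _++_)
open import Data.List.Properties using (++-assoc; ++-identityʳ)
open import Data.List.Relation.Unary.All using (All; []; _∷_)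
open import Data.List.Relation.Unary.All.Properties using (++⁺)
open import Data.Maybe using (just)
open import Data.Product using (Σ; ∃; ∃₂; _×_; _,_)
open import Relation.Binary.PropositionalEquality using (_≡_; refl; sym; trans; cong)
open import Relation.Nullary using (yes; no; ¬_)
open import Data.Empty using (⊥-elim)
open import Function.Bundles using (_⇔_; mk⇔)

module FillRules (x : ℕ) where

  fill-hit : ∀ {y b bs} → x ≡ y → fill x (rfvar y) (b ∷ bs) ≡ just (b , bs)
  fill-hit {y} x≡y with x ≟ y
  ... | yes _  = refl
  ... | no x≢y = ⊥-elim (x≢y x≡y)

  fill-miss : ∀ {y bs} → ¬ x ≡ y → fill x (rfvar y) bs ≡ just (rfvar y , bs)
  fill-miss {y} x≢y with x ≟ y
  ... | yes x≡y = ⊥-elim (x≢y x≡y)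
  ... | no _    = refl

  fill-lam : ∀ a {bs a' rs} → fill x a bs ≡ just (a' , rs) →
             fill x (rlam a) bs ≡ just (rlam a' , rs)
  fill-lam a eq rewrite eq = refl

  fill-app : ∀ c ds {bs c' rs ds' ts} →
             fill x c bs ≡ just (c' , rs) → fillList x ds rs ≡ just (ds' , ts) →
             fill x (rapp c ds) bs ≡ just (rapp c' ds' , ts)
  fill-app c ds eq₁ eq₂ rewrite eq₁ | eq₂ = refl

  fillList-cons : ∀ d ds {bs d' rs ds' ts} →
                  fill x d bs ≡ just (d' , rs) → fillList x ds rs ≡ just (ds' , ts) →
                  fillList x (d ∷ ds) bs ≡ just (d' ∷ ds' , ts)
  fillList-cons d ds eq₁ eq₂ rewrite eq₁ | eq₂ = refl

  fill-lam⁻¹ : ∀ a {bs e rs} → fill x (rlam a) bs ≡ just (e , rs) →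
               ∃ λ a' → fill x a bs ≡ just (a' , rs) × e ≡ rlam a'
  fill-lam⁻¹ a {bs} eq with fill x a bs
  fill-lam⁻¹ a refl | just (a' , _) = a' , refl , refl

  fill-app⁻¹ : ∀ c ds {bs e ts} → fill x (rapp c ds) bs ≡ just (e , ts) →
               ∃₂ λ c' ds' → ∃ λ rs → fill x c bs ≡ just (c' , rs)
                 × fillList x ds rs ≡ just (ds' , ts) × e ≡ rapp c' ds'
  fill-app⁻¹ c ds {bs} eq with fill x c bs
  ... | just (c' , rs) with fillList x ds rs in eq₂
  fill-app⁻¹ c ds refl | just (c' , rs) | just (ds' , _) = c' , ds' , rs , refl , eq₂ , refl

  fillList-cons⁻¹ : ∀ d ds {bs es ts} → fillList x (d ∷ ds) bs ≡ just (es , ts) →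
                    ∃₂ λ d' ds' → ∃ λ rs → fill x d bs ≡ just (d' , rs)
                      × fillList x ds rs ≡ just (ds' , ts) × es ≡ d' ∷ ds'
  fillList-cons⁻¹ d ds {bs} eq with fill x d bs
  ... | just (d' , rs) with fillList x ds rs in eq₂
  fillList-cons⁻¹ d ds refl | just (d' , rs) | just (ds' , _) = d' , ds' , rs , refl , eq₂ , refl

  rsubst-fill⁺ : ∀ a {bs e} → fill x a bs ≡ just (e , []) → rsubst x a bs ≡ just e
  rsubst-fill⁺ a eq rewrite eq = refl

  rsubst-fill⁻ : ∀ a bs {e} → rsubst x a bs ≡ just e → fill x a bs ≡ just (e , [])
  rsubst-fill⁻ a bs eq with fill x a bs
  rsubst-fill⁻ a bs refl | just (_ , []) = refl

module Substitution (x : ℕ) (N : Term) where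
  open FillRules x

  mutual
    fill-sound : ∀ {M a bs e rs} → a ∈Tr M → All (_∈Tr N) bs →
                 fill x a bs ≡ just (e , rs) → e ∈Tr subst x N M × All (_∈Tr N) rs
    fill-sound {fvar y} {bs = bs} tr-fvar Nbs eq with x ≟ y
    fill-sound {bs = b ∷ _} tr-fvar (Nb ∷ Nbs) refl | yes _ = Nb , Nbs
    fill-sound              tr-fvar Nbs         refl | no _  = tr-fvar , Nbs
    fill-sound tr-bvar Nbs refl = tr-bvar , Nbs
    fill-sound (tr-lam {a} a∈M) Nbs eq with fill-lam⁻¹ a eq
    ... | _ , eq₁ , refl with fill-sound a∈M Nbs eq₁
    ...   | a'∈ , Nrs = tr-lam a'∈ , Nrs
    fill-sound (tr-app {c} {ds = ds} c∈P ds∈Q) Nbs eq with fill-app⁻¹ c ds eq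
    ... | _ , _ , _ , eq₁ , eq₂ , refl with fill-sound c∈P Nbs eq₁
    ...   | c'∈ , Nrs with fillList-sound ds∈Q Nrs eq₂
    ...     | ds'∈ , Nts = tr-app c'∈ ds'∈ , Nts

    fillList-sound : ∀ {Q ds bs es rs} → All (_∈Tr Q) ds → All (_∈Tr N) bs →
                     fillList x ds bs ≡ just (es , rs) →
                     All (_∈Tr subst x N Q) es × All (_∈Tr N) rs
    fillList-sound [] Nbs refl = [] , Nbs
    fillList-sound {ds = d ∷ ds} (d∈Q ∷ ds∈Q) Nbs eq with fillList-cons⁻¹ d ds eq
    ... | _ , _ , _ , eq₁ , eq₂ , refl with fill-sound d∈Q Nbs eq₁
    ...   | d'∈ , Nrs with fillList-sound ds∈Q Nrs eq₂
    ...     | ds'∈ , Nts = d'∈ ∷ ds'∈ , Nts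

  Decomposition : Term → RTerm → List RTerm → Set
  Decomposition M e rs = Σ RTerm λ a → Σ (List RTerm) λ bs →
    a ∈Tr M × All (_∈Tr N) bs × fill x a (bs ++ rs) ≡ just (e , rs)

  DecompositionList : Term → List RTerm → List RTerm → Set
  DecompositionList Q es rs = Σ (List RTerm) λ ds → Σ (List RTerm) λ bs →
    All (_∈Tr Q) ds × All (_∈Tr N) bs × fillList x ds (bs ++ rs) ≡ just (es , rs)

  -- Completeness: every expansion of M[N/x] decomposes.  For an application
  -- the arguments are decomposed first, so that the list consumed by the
  -- head can be placed in front of theirs.
  mutual
    fill-complete : ∀ M {e} → e ∈Tr subst x N M → ∀ rs → Decomposition M e rs
    fill-complete (fvar y) e∈ rs with x ≟ y
    ... | yes x≡y = rfvar y , _ ∷ [] , tr-fvar , e∈ ∷ [] , fill-hit x≡y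
    fill-complete (fvar y) tr-fvar rs | no x≢y = rfvar y , [] , tr-fvar , [] , fill-miss x≢y
    fill-complete (bvar i) tr-bvar rs = rbvar i , [] , tr-bvar , [] , refl
    fill-complete (lam M) (tr-lam e∈) rs with fill-complete M e∈ rs
    ... | a , bs , a∈M , Nbs , eq = rlam a , bs , tr-lam a∈M , Nbs , fill-lam a eq
    fill-complete (app P Q) (tr-app c∈ es∈) rs with fillList-complete Q es∈ rs
    ... | ds , bs₂ , ds∈Q , Nbs₂ , eq₂ with fill-complete P c∈ (bs₂ ++ rs)
    ...   | c , bs₁ , c∈P , Nbs₁ , eq₁ =
      rapp c ds , bs₁ ++ bs₂ , tr-app c∈P ds∈Q , ++⁺ Nbs₁ Nbs₂ ,
      fill-app c ds (trans (cong (fill x c) (++-assoc bs₁ bs₂ rs)) eq₁) eq₂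

    fillList-complete : ∀ Q {es} → All (_∈Tr subst x N Q) es → ∀ rs →
                        DecompositionList Q es rs
    fillList-complete Q [] rs = [] , [] , [] , [] , refl
    fillList-complete Q (e∈ ∷ es∈) rs with fillList-complete Q es∈ rs
    ... | ds , bs₂ , ds∈Q , Nbs₂ , eq₂ with fill-complete Q e∈ (bs₂ ++ rs)
    ...   | d , bs₁ , d∈Q , Nbs₁ , eq₁ =
      d ∷ ds , bs₁ ++ bs₂ , d∈Q ∷ ds∈Q , ++⁺ Nbs₁ Nbs₂ ,
      fillList-cons d ds (trans (cong (fill x d) (++-assoc bs₁ bs₂ rs)) eq₁) eq₂

mainTheorem8 : (M N : Term) (x : ℕ) → LC M → LC N → (e : RTerm) →
    (e ∈Tr subst x N M) ⇔
    Σ RTerm (λ a → Σ (List RTerm) (λ bs →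
      a ∈Tr M × All (_∈Tr N) bs × rsubst x a bs ≡ just e))
mainTheorem8 M N x _ _ e = mk⇔ decompose compose
  where
  open FillRules x
  open Substitution x N

  decompose : e ∈Tr subst x N M →
              Σ RTerm λ a → Σ (List RTerm) λ bs →
                a ∈Tr M × All (_∈Tr N) bs × rsubst x a bs ≡ just e
  decompose e∈ with fill-complete M e∈ []
  ... | a , bs , a∈M , Nbs , eq =
    a , bs , a∈M , Nbs ,
    rsubst-fill⁺ a (trans (cong (fill x a) (sym (++-identityʳ bs))) eq)

  compose : (Σ RTerm λ a → Σ (List RTerm) λ bs →
               a ∈Tr M × All (_∈Tr N) bs × rsubst x a bs ≡ just e) →
            e ∈Tr subst x N M
  compose (a , bs , a∈M , Nbs , eq) with fill-sound a∈M Nbs (rsubst-fill⁻ a bs eq)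
  ... | e∈ , _ = e∈
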